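{- Let $n,k,r,s,a$ be integers with $k,r\ge2$, $n\ge rk$, $0\le s<k$, $a\ge0$ and $n>a+s$. Then $$\mathrm{ecd}^r(\mathcal{H}(n,k,a,s),s)=\begin{cases} n-r(k-s-1) & \text{if } a\le k-s-1,\\ n-r(k-s-1)-\left\lfloor\frac{a}{k-s}\right\rfloor & \text{if } k-s\le a\le r(k-s)-2,\\ n-a & \text{if } a\ge r(k-s)-1.\end{cases}$$
   Context: For $s'\ge0$ and $A,B\subseteq[n]$, write $A\subseteq_{s'}B$ if there is a set $E$ with $|E|\le s'$ and $A\setminus E\subseteq B$. $\mathcal{H}(n,k,a,s)$ is the family of all $k$-subsets $F\subseteq[n]$ with $F\not\subseteq_s\{n-a+1,\dots,n\}$. An equitable partition of $X$ into $r$ parts is a partition $X=X_1\cup\dots\cup X_r$ (parts possibly empty) with $||X_i|-|X_j||\le1$ for all $i,j$. For a family $\mathcal{F}$ of subsets of $[n]$, $\mathrm{ecd}^r(\mathcal{F},s')$ is the minimum size of a set $X_0\subseteq[n]$ such that there is an equitable partition $[n]\setminus X_0=X_1\cup\dots\cup X_r$ with no $F\in\mathcal{F}$ and $i\in\{1,\dots,r\}$ satisfying $F\subseteq_{s'}X_i$. -}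

module Defs where

open import Data.Nat using (ℕ; zero; suc; _+_; _*_; _∸_; _≤_; _<_; _≥_)
open import Data.Fin using (Fin; toℕ)
open import Data.Fin.Subset using (Subset; _∈_; _∉_; _⊆_; _─_; ∣_∣; ∁; ⊥)
open import Data.Product using (Σ; ∃; _×_; _,_)
open import Relation.Nullary using (¬_)
open import Relation.Binary.PropositionalEquality using (_≡_; _≢_)
open import Data.Vec using (tabulate)
open import Data.Bool using (Bool; true; false)
open import Relation.Nullary.Decidable using (⌊_⌋)
open import Data.Nat using (_≤?_)

-- Subsets of [n] are Subset n (element i : Fin n represents the number toℕ i + 1).
-- A family of subsets of [n] is a predicate on Subset n.
Family : ℕ → Set₁
Family n = Subset n → Set

_⊆[_]_ : ∀ {n} → Subset n → ℕ → Subset n → Set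
A ⊆[ s' ] B = ∃ λ E → ∣ E ∣ ≤ s' × (A ─ E) ⊆ B

-- The set {n-a+1, …, n}: (0-based) indices i with toℕ i + a ≥ n.
top : (n a : ℕ) → Subset n
top n a = tabulate (λ i → ⌊ n ≤? toℕ i + a ⌋)

H : (n k a s : ℕ) → Family n
H n k a s F = ∣ F ∣ ≡ k × ¬ (F ⊆[ s ] top n a)

record EquitablePartition {n} (r : ℕ) (X₀ : Subset n) (X : Fin r → Subset n) : Set where
  field
    disjoint : ∀ i j → i ≢ j → ∀ x → x ∈ X i → x ∉ X j
    inside   : ∀ i → X i ⊆ ∁ X₀
    covers   : ∀ x → x ∉ X₀ → ∃ λ i → x ∈ X i
    balanced : ∀ i j → ∣ X i ∣ ≤ suc ∣ X j ∣

Admissible : ∀ {n} → ℕ → Family n → ℕ → Subset n → Set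
Admissible {n} r 𝓕 s' X₀ =
  ∃ λ (X : Fin r → Subset n) → EquitablePartition r X₀ X ×
    (∀ F i → 𝓕 F → ¬ (F ⊆[ s' ] X i))

IsEcd : ∀ {n} → ℕ → Family n → ℕ → ℕ → Set
IsEcd {n} r 𝓕 s' m =
  (∃ λ X₀ → Admissible r 𝓕 s' X₀ × ∣ X₀ ∣ ≡ m) ×
  (∀ X₀ → Admissible r 𝓕 s' X₀ → m ≤ ∣ X₀ ∣)

-- Write k = s + c + 1 and T = {n-a+1, …, n}, so |T| = a. A part P s-contains no member of H
-- exactly when P ⊆ T or |P| ≤ c: if |P| > c and b ∈ P lies outside T, then c + 1 points of P
-- and s + 1 points outside T, both sets containing b, extend to a k-set that s-fits into P
-- but not into T. Hence ecd = n − M, where M is the largest total size of r disjoint parts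
-- whose sizes differ by at most one and each of which lies in T or has at most c elements.
-- If some part has at most c elements, all have at most c + 1 and those of size c + 1 lie in T,
-- so (c + 1) M ≤ r c (c + 1) + a; otherwise every part lies in T and M ≤ a. Equitable
-- packings, filling T first, attain r c + ⌊a/(c+1)⌋ when a < r (c + 1) and a otherwise.

module Submission where

open import Data.Bool using (true; false)
open import Data.Fin using (Fin; zero; suc; toℕ) renaming (_≟_ to _≟ᶠ_)
open import Data.Fin.Properties using (any?)
open import Data.Fin.Subset
open import Data.Fin.Subset.Properties
open import Data.Nat
  using (ℕ; zero; suc; _+_; _*_; _∸_; _⊓_; _≤_; _<_; z≤n; s≤s; s≤s⁻¹; NonZero)
open import Data.Nat.Divisibility using (n∣m*n)
open import Data.Nat.DivMod
open import Data.Nat.Properties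
open import Algebra.Properties.Semiring.Sum +-*-semiring
  using (sum-syntax; sum-cong-≗; ∑-distrib-+; *-distribˡ-sum)
open import Data.Nat.Tactic.RingSolver using (solve-∀)
open import Data.Product using (∃; _×_; _,_)
open import Data.Sum using (_⊎_; inj₁; inj₂)
open import Data.Vec using ([]; _∷_; here; there)
import Data.Vec.Functional as Vector
open import Data.Vec.Properties using (tabulate-cong)
open import Function using (_∘_)
open import Function.Bundles using (mk⇔)
open import Relation.Nullary using (¬_; Dec; yes; no; contradiction)
open import Relation.Nullary.Decidable using (does; ⌊_⌋; isYes≗does; does-⇔)
open import Relation.Binary.PropositionalEquality

open import Defs

Disjoint : ∀ {n} → Subset n → Subset n → Set
Disjoint p q = ∀ x → x ∈ p → x ∉ q

Disjoint-tail : ∀ {n} {b c} {p q : Subset n} → Disjoint (b ∷ p) (c ∷ q) → Disjoint p q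
Disjoint-tail p#q x x∈p x∈q = p#q (suc x) (there x∈p) (there x∈q)

x∈p─q⇒x∉q : ∀ {n} {x : Fin n} (p q : Subset n) → x ∈ p ─ q → x ∉ q
x∈p─q⇒x∉q (_ ∷ p) (true ∷ q) () here
x∈p─q⇒x∉q (_ ∷ p) (_ ∷ q) (there x∈) (there x∈q) = x∈p─q⇒x∉q p q x∈ x∈q

p⊆q⇒p─r⊆q─r : ∀ {n} {p q : Subset n} r → p ⊆ q → p ─ r ⊆ q ─ r
p⊆q⇒p─r⊆q─r {p = p} r p⊆q x∈p─r = x∈p∧x∉q⇒x∈p─q (p⊆q (p─q⊆p p r x∈p─r)) (x∈p─q⇒x∉q p r x∈p─r)

x∈p⇒⁅x⁆⊆p : ∀ {n} {x : Fin n} {p : Subset n} → x ∈ p → ⁅ x ⁆ ⊆ p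
x∈p⇒⁅x⁆⊆p x∈p y∈⁅x⁆ rewrite x∈⁅y⁆⇒x≡y _ y∈⁅x⁆ = x∈p

∣p─q∣+∣q∣≡∣p∣ : ∀ {n} (p q : Subset n) → q ⊆ p → ∣ p ─ q ∣ + ∣ q ∣ ≡ ∣ p ∣
∣p─q∣+∣q∣≡∣p∣ []          []          _   = refl
∣p─q∣+∣q∣≡∣p∣ (true ∷ p)  (true ∷ q)  q⊆p =
  trans (+-suc _ _) (cong suc (∣p─q∣+∣q∣≡∣p∣ p q (drop-∷-⊆ q⊆p)))
∣p─q∣+∣q∣≡∣p∣ (true ∷ p)  (false ∷ q) q⊆p = cong suc (∣p─q∣+∣q∣≡∣p∣ p q (drop-∷-⊆ q⊆p))
∣p─q∣+∣q∣≡∣p∣ (false ∷ p) (true ∷ q)  q⊆p with () ← q⊆p here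
∣p─q∣+∣q∣≡∣p∣ (false ∷ p) (false ∷ q) q⊆p = ∣p─q∣+∣q∣≡∣p∣ p q (drop-∷-⊆ q⊆p)

m+k≤∣p∣⇒k≤∣p─q∣ : ∀ {n m k} {p q : Subset n} → q ⊆ p → ∣ q ∣ ≡ m → m + k ≤ ∣ p ∣ → k ≤ ∣ p ─ q ∣
m+k≤∣p∣⇒k≤∣p─q∣ {m = m} {k} {p} {q} q⊆p ∣q∣≡m m+k≤∣p∣ = +-cancelˡ-≤ m k ∣ p ─ q ∣ (begin
  m + k             ≤⟨ m+k≤∣p∣ ⟩
  ∣ p ∣             ≡⟨ ∣p─q∣+∣q∣≡∣p∣ p q q⊆p ⟨
  ∣ p ─ q ∣ + ∣ q ∣ ≡⟨ +-comm _ ∣ q ∣ ⟩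
  ∣ q ∣ + ∣ p ─ q ∣ ≡⟨ cong (_+ ∣ p ─ q ∣) ∣q∣≡m ⟩
  m + ∣ p ─ q ∣     ∎)
  where open ≤-Reasoning

∣p∣≤∣p─q∣+∣q∣ : ∀ {n} (p q : Subset n) → ∣ p ∣ ≤ ∣ p ─ q ∣ + ∣ q ∣
∣p∣≤∣p─q∣+∣q∣ []          []          = z≤n
∣p∣≤∣p─q∣+∣q∣ (true ∷ p)  (true ∷ q)  = ≤-trans (s≤s (∣p∣≤∣p─q∣+∣q∣ p q)) (≤-reflexive (sym (+-suc _ _)))
∣p∣≤∣p─q∣+∣q∣ (true ∷ p)  (false ∷ q) = s≤s (∣p∣≤∣p─q∣+∣q∣ p q)
∣p∣≤∣p─q∣+∣q∣ (false ∷ p) (true ∷ q)  = ≤-trans (∣p∣≤∣p─q∣+∣q∣ p q) (+-monoʳ-≤ _ (n≤1+n _))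
∣p∣≤∣p─q∣+∣q∣ (false ∷ p) (false ∷ q) = ∣p∣≤∣p─q∣+∣q∣ p q

∣p∪q∣≤∣p∣+∣q∣ : ∀ {n} (p q : Subset n) → ∣ p ∪ q ∣ ≤ ∣ p ∣ + ∣ q ∣
∣p∪q∣≤∣p∣+∣q∣ []          []          = z≤n
∣p∪q∣≤∣p∣+∣q∣ (true ∷ p)  (b ∷ q)     = s≤s (≤-trans (∣p∪q∣≤∣p∣+∣q∣ p q) (+-monoʳ-≤ _ (∣p∣≤∣x∷p∣ b q)))
∣p∪q∣≤∣p∣+∣q∣ (false ∷ p) (true ∷ q)  = ≤-trans (s≤s (∣p∪q∣≤∣p∣+∣q∣ p q)) (≤-reflexive (sym (+-suc _ _)))
∣p∪q∣≤∣p∣+∣q∣ (false ∷ p) (false ∷ q) = ∣p∪q∣≤∣p∣+∣q∣ p q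

∣p∪q∣<∣p∣+∣q∣ : ∀ {n} {x : Fin n} (p q : Subset n) → x ∈ p → x ∈ q → ∣ p ∪ q ∣ < ∣ p ∣ + ∣ q ∣
∣p∪q∣<∣p∣+∣q∣ {x = x} p q x∈p x∈q = begin-strict
  ∣ p ∪ q ∣         ≤⟨ p⊆q⇒∣p∣≤∣q∣ p∪q⊆[p-x]∪q ⟩
  ∣ (p - x) ∪ q ∣   ≤⟨ ∣p∪q∣≤∣p∣+∣q∣ (p - x) q ⟩
  ∣ p - x ∣ + ∣ q ∣ <⟨ +-monoˡ-< ∣ q ∣ (x∈p⇒∣p-x∣<∣p∣ x∈p) ⟩
  ∣ p ∣ + ∣ q ∣     ∎
  where
  open ≤-Reasoning
  p∪q⊆[p-x]∪q : p ∪ q ⊆ (p - x) ∪ q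
  p∪q⊆[p-x]∪q {y} y∈ with x∈p∪q⁻ p q y∈ | y ≟ᶠ x
  ... | inj₂ y∈q | _        = q⊆p∪q _ q y∈q
  ... | inj₁ _   | yes refl = q⊆p∪q _ q x∈q
  ... | inj₁ y∈p | no  y≢x  = p⊆p∪q q (x∈p∧x≢y⇒x∈p-y y∈p y≢x)

∣p∪q∣≡∣p∣+∣q∣ : ∀ {n} (p q : Subset n) → Disjoint p q → ∣ p ∪ q ∣ ≡ ∣ p ∣ + ∣ q ∣
∣p∪q∣≡∣p∣+∣q∣ []          []          _ = refl
∣p∪q∣≡∣p∣+∣q∣ (true ∷ p)  (true ∷ q)  p#q with () ← p#q zero here here
∣p∪q∣≡∣p∣+∣q∣ (true ∷ p)  (false ∷ q) p#q = cong suc (∣p∪q∣≡∣p∣+∣q∣ p q (Disjoint-tail p#q))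
∣p∪q∣≡∣p∣+∣q∣ (false ∷ p) (true ∷ q)  p#q =
  trans (cong suc (∣p∪q∣≡∣p∣+∣q∣ p q (Disjoint-tail p#q))) (sym (+-suc _ _))
∣p∪q∣≡∣p∣+∣q∣ (false ∷ p) (false ∷ q) p#q = ∣p∪q∣≡∣p∣+∣q∣ p q (Disjoint-tail p#q)

subset-between : ∀ {n} (r p : Subset n) m → r ⊆ p → ∣ r ∣ ≤ m → m ≤ ∣ p ∣ →
  ∃ λ g → r ⊆ g × g ⊆ p × ∣ g ∣ ≡ m
subset-between []          []         zero    _   _   _ = [] , ⊆-refl , ⊆-refl , refl
subset-between (true ∷ r)  (false ∷ p) m      r⊆p _   _ with () ← r⊆p here
subset-between (true ∷ r)  (true ∷ p) (suc m) r⊆p (s≤s r≤m) (s≤s m≤p)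
  with g , r⊆g , g⊆p , ∣g∣≡m ← subset-between r p m (drop-∷-⊆ r⊆p) r≤m m≤p
  = true ∷ g , in⊆in r⊆g , in⊆in g⊆p , cong suc ∣g∣≡m
subset-between (false ∷ r) (false ∷ p) m      r⊆p r≤m m≤p
  with g , r⊆g , g⊆p , ∣g∣≡m ← subset-between r p m (drop-∷-⊆ r⊆p) r≤m m≤p
  = false ∷ g , out⊆ r⊆g , out⊆ g⊆p , ∣g∣≡m
subset-between (false ∷ r) (true ∷ p) m       r⊆p r≤m m≤1+p with m ≤? ∣ p ∣
... | yes m≤p
  with g , r⊆g , g⊆p , ∣g∣≡m ← subset-between r p m (drop-∷-⊆ r⊆p) r≤m m≤p
  = false ∷ g , out⊆ r⊆g , out⊆ g⊆p , ∣g∣≡m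
subset-between (false ∷ r) (true ∷ p) zero    _   _   _ | no 0≰p = contradiction z≤n 0≰p
subset-between (false ∷ r) (true ∷ p) (suc m) r⊆p _ (s≤s m≤p) | no m≮p
  with g , r⊆g , g⊆p , ∣g∣≡m ← subset-between r p m (drop-∷-⊆ r⊆p)
         (≤-trans (p⊆q⇒∣p∣≤∣q∣ (drop-∷-⊆ r⊆p)) (≮⇒≥ m≮p)) m≤p
  = true ∷ g , out⊆ r⊆g , in⊆in g⊆p , cong suc ∣g∣≡m

subset-of-size : ∀ {n} (p : Subset n) m → m ≤ ∣ p ∣ → ∃ λ g → g ⊆ p × ∣ g ∣ ≡ m
subset-of-size {n} p m m≤∣p∣
  with g , _ , g⊆p , ∣g∣≡m ← subset-between ⊥ p m ⊥⊆ (subst (_≤ m) (sym (∣⊥∣≡0 n)) z≤n) m≤∣p∣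
  = g , g⊆p , ∣g∣≡m

⌊1+m≤?1+n⌋≡⌊m≤?n⌋ : ∀ m n → ⌊ suc m ≤? suc n ⌋ ≡ ⌊ m ≤? n ⌋
⌊1+m≤?1+n⌋≡⌊m≤?n⌋ m n = begin
  ⌊ suc m ≤? suc n ⌋    ≡⟨ isYes≗does (suc m ≤? suc n) ⟩
  does (suc m ≤? suc n) ≡⟨ does-⇔ (mk⇔ s≤s⁻¹ s≤s) (suc m ≤? suc n) (m ≤? n) ⟩
  does (m ≤? n)         ≡⟨ isYes≗does (m ≤? n) ⟨
  ⌊ m ≤? n ⌋            ∎
  where open ≡-Reasoning

top-suc : ∀ n a → top (suc n) a ≡ ⌊ suc n ≤? a ⌋ ∷ top n a
top-suc zero    a = refl
top-suc (suc n) a = cong (⌊ 2 + n ≤? a ⌋ ∷_) (tabulate-cong λ i → ⌊1+m≤?1+n⌋≡⌊m≤?n⌋ (suc n) (toℕ i + a))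

∣top∣≡a⊓n : ∀ n a → ∣ top n a ∣ ≡ a ⊓ n
∣top∣≡a⊓n zero    a = sym (⊓-zeroʳ a)
∣top∣≡a⊓n (suc n) a = trans (cong ∣_∣ (top-suc n a)) (count-head (suc n ≤? a))
  where
  count-head : (d : Dec (suc n ≤ a)) → ∣ ⌊ d ⌋ ∷ top n a ∣ ≡ a ⊓ suc n
  count-head (yes n<a) = begin
    suc ∣ top n a ∣ ≡⟨ cong suc (trans (∣top∣≡a⊓n n a) (m≥n⇒m⊓n≡n (<⇒≤ n<a))) ⟩
    suc n           ≡⟨ m≥n⇒m⊓n≡n n<a ⟨
    a ⊓ suc n       ∎
    where open ≡-Reasoning
  count-head (no n≮a) = begin
    ∣ top n a ∣ ≡⟨ ∣top∣≡a⊓n n a ⟩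
    a ⊓ n       ≡⟨ m≤n⇒m⊓n≡m (≮⇒≥ n≮a) ⟩
    a           ≡⟨ m≤n⇒m⊓n≡m (m≤n⇒m≤1+n (≮⇒≥ n≮a)) ⟨
    a ⊓ suc n   ∎
    where open ≡-Reasoning

∣top∣≡a : ∀ {n a} → a ≤ n → ∣ top n a ∣ ≡ a
∣top∣≡a {n} {a} a≤n = trans (∣top∣≡a⊓n n a) (m≤n⇒m⊓n≡m a≤n)

s<∣∁top∣ : ∀ {n a s} → a + s < n → s < ∣ ∁ (top n a) ∣
s<∣∁top∣ {n} {a} {s} a+s<n = begin-strict
  s                 <⟨ m+n≤o⇒m≤o∸n (suc s) (≤-trans (≤-reflexive (cong suc (+-comm s a))) a+s<n) ⟩
  n ∸ a             ≡⟨ cong (n ∸_) (∣top∣≡a (m+n≤o⇒m≤o a (<⇒≤ a+s<n))) ⟨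
  n ∸ ∣ top n a ∣    ≡⟨ ∣∁p∣≡n∸∣p∣ (top n a) ⟨
  ∣ ∁ (top n a) ∣    ∎
  where open ≤-Reasoning

⊆[]⇒∣∣≤∣∣+ : ∀ {n s} {f p : Subset n} → f ⊆[ s ] p → ∣ f ∣ ≤ ∣ p ∣ + s
⊆[]⇒∣∣≤∣∣+ {f = f} (e , ∣e∣≤s , f─e⊆p) =
  ≤-trans (∣p∣≤∣p─q∣+∣q∣ f e) (+-mono-≤ (p⊆q⇒∣p∣≤∣q∣ f─e⊆p) ∣e∣≤s)

⊆[]-intro : ∀ {n s} {g f p : Subset n} → g ⊆ f → g ⊆ p → ∣ f ∣ ≤ ∣ g ∣ + s → f ⊆[ s ] p
⊆[]-intro {s = s} {g} {f} {p} g⊆f g⊆p ∣f∣≤ = f ─ g , ∣f─g∣≤s , f─[f─g]⊆p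
  where
  ∣f─g∣≤s : ∣ f ─ g ∣ ≤ s
  ∣f─g∣≤s = +-cancelʳ-≤ ∣ g ∣ _ _ (begin
    ∣ f ─ g ∣ + ∣ g ∣ ≡⟨ ∣p─q∣+∣q∣≡∣p∣ f g g⊆f ⟩
    ∣ f ∣             ≤⟨ ∣f∣≤ ⟩
    ∣ g ∣ + s         ≡⟨ +-comm ∣ g ∣ s ⟩
    s + ∣ g ∣         ∎)
    where open ≤-Reasoning
  f─[f─g]⊆p : f ─ (f ─ g) ⊆ p
  f─[f─g]⊆p {x} x∈ with x ∈? g
  ... | yes x∈g = g⊆p x∈g
  ... | no  x∉g = contradiction (x∈p∧x∉q⇒x∈p─q (p─q⊆p f _ x∈) x∉g) (x∈p─q⇒x∉q f (f ─ g) x∈)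

⊈[]-intro : ∀ {n s} {d f p : Subset n} → d ⊆ f → Disjoint d p → s < ∣ d ∣ → ¬ f ⊆[ s ] p
⊈[]-intro {d = d} d⊆f d#p s<∣d∣ (e , ∣e∣≤s , f─e⊆p) =
  <⇒≱ s<∣d∣ (≤-trans (p⊆q⇒∣p∣≤∣q∣ d⊆e) ∣e∣≤s)
  where
  d⊆e : d ⊆ e
  d⊆e {x} x∈d with x ∈? e
  ... | yes x∈e = x∈e
  ... | no  x∉e = contradiction (f─e⊆p (x∈p∧x∉q⇒x∈p─q (d⊆f x∈d) x∉e)) (d#p x x∈d)

large-escaping-part-contains : ∀ {n s c} {t p : Subset n} {b : Fin n} →
  suc (s + c) ≤ n → s < ∣ ∁ t ∣ → b ∈ p → b ∉ t → c < ∣ p ∣ →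
  ∃ λ f → (∣ f ∣ ≡ suc (s + c) × ¬ f ⊆[ s ] t) × f ⊆[ s ] p
large-escaping-part-contains {n} {s} {c} {t} {p} {b} k≤n s<∣∁t∣ b∈p b∉t c<∣p∣
  with d , ⁅b⁆⊆d , d⊆∁t , ∣d∣≡1+s ← subset-between ⁅ b ⁆ (∁ t) (suc s)
         (x∈p⇒⁅x⁆⊆p (x∉p⇒x∈∁p b∉t)) (subst (_≤ suc s) (sym (∣⁅x⁆∣≡1 b)) (s≤s z≤n)) s<∣∁t∣
  with g , ⁅b⁆⊆g , g⊆p , ∣g∣≡1+c ← subset-between ⁅ b ⁆ p (suc c)
         (x∈p⇒⁅x⁆⊆p b∈p) (subst (_≤ suc c) (sym (∣⁅x⁆∣≡1 b)) (s≤s z≤n)) c<∣p∣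
  with f , d∪g⊆f , _ , ∣f∣≡k ← subset-between (d ∪ g) ⊤ (suc (s + c)) ⊆⊤
         (s≤s⁻¹ (≤-trans (∣p∪q∣<∣p∣+∣q∣ d g (⁅b⁆⊆d (x∈⁅x⁆ b)) (⁅b⁆⊆g (x∈⁅x⁆ b)))
                         (≤-reflexive (trans (cong₂ _+_ ∣d∣≡1+s ∣g∣≡1+c) (cong suc (+-suc s c))))))
         (≤-trans k≤n (≤-reflexive (sym (∣⊤∣≡n n))))
  = f , (∣f∣≡k , ⊈[]-intro (⊆-trans (p⊆p∪q g) d∪g⊆f) d#t (≤-reflexive (sym ∣d∣≡1+s)))
      , ⊆[]-intro (⊆-trans (q⊆p∪q d g) d∪g⊆f) g⊆p
          (≤-reflexive (trans ∣f∣≡k (trans (cong suc (+-comm s c)) (cong (_+ s) (sym ∣g∣≡1+c)))))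
  where
  d#t : Disjoint d t
  d#t x x∈d = x∈∁p⇒x∉p (d⊆∁t x∈d)

-- ecd as a maximum over free equitable families

PairwiseDisjoint : ∀ {r n} → (Fin r → Subset n) → Set
PairwiseDisjoint X = ∀ i j → i ≢ j → Disjoint (X i) (X j)

PairwiseDisjoint-tail : ∀ {r n} {X : Fin (suc r) → Subset n} →
  PairwiseDisjoint X → PairwiseDisjoint (X ∘ suc)
PairwiseDisjoint-tail X# i j i≢j = X# (suc i) (suc j) λ { refl → i≢j refl }

Balanced : ∀ {r} → (Fin r → ℕ) → Set
Balanced x = ∀ i j → x i ≤ suc (x j)

⋃ᶠ : ∀ {r n} → (Fin r → Subset n) → Subset n
⋃ᶠ = Vector.foldr _∪_ ⊥

x∈⋃ᶠ⁺ : ∀ {r n} (X : Fin r → Subset n) i {x} → x ∈ X i → x ∈ ⋃ᶠ X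
x∈⋃ᶠ⁺ X zero    x∈ = p⊆p∪q _ x∈
x∈⋃ᶠ⁺ X (suc i) x∈ = q⊆p∪q (X zero) _ (x∈⋃ᶠ⁺ (X ∘ suc) i x∈)

x∈⋃ᶠ⁻ : ∀ {r n} (X : Fin r → Subset n) {x} → x ∈ ⋃ᶠ X → ∃ λ i → x ∈ X i
x∈⋃ᶠ⁻ {zero}  X x∈ = contradiction x∈ ∉⊥
x∈⋃ᶠ⁻ {suc r} X x∈ with x∈p∪q⁻ (X zero) _ x∈
... | inj₁ x∈X₀ = zero , x∈X₀
... | inj₂ x∈⋃ with i , x∈Xᵢ ← x∈⋃ᶠ⁻ (X ∘ suc) x∈⋃ = suc i , x∈Xᵢ

∣⋃ᶠ∣≡∑∣∣ : ∀ {r n} (X : Fin r → Subset n) → PairwiseDisjoint X → ∣ ⋃ᶠ X ∣ ≡ ∑[ i < r ] ∣ X i ∣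
∣⋃ᶠ∣≡∑∣∣ {zero}  {n} X X# = ∣⊥∣≡0 n
∣⋃ᶠ∣≡∑∣∣ {suc r} X X# = begin
  ∣ X zero ∪ ⋃ᶠ (X ∘ suc) ∣             ≡⟨ ∣p∪q∣≡∣p∣+∣q∣ (X zero) _ X₀#⋃ ⟩
  ∣ X zero ∣ + ∣ ⋃ᶠ (X ∘ suc) ∣         ≡⟨ cong (∣ X zero ∣ +_) ∣⋃tail∣≡∑ ⟩
  ∣ X zero ∣ + ∑[ i < r ] ∣ X (suc i) ∣ ∎
  where
  open ≡-Reasoning
  ∣⋃tail∣≡∑ = ∣⋃ᶠ∣≡∑∣∣ (X ∘ suc) (PairwiseDisjoint-tail X#)
  X₀#⋃ : Disjoint (X zero) (⋃ᶠ (X ∘ suc))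
  X₀#⋃ x x∈X₀ x∈⋃ with i , x∈Xᵢ ← x∈⋃ᶠ⁻ (X ∘ suc) x∈⋃ = X# zero (suc i) (λ ()) x x∈X₀ x∈Xᵢ

record FreeFamily {r n} (𝓕 : Family n) (s' : ℕ) (X : Fin r → Subset n) : Set where
  field
    disjoint : PairwiseDisjoint X
    balanced : Balanced (∣_∣ ∘ X)
    avoids   : ∀ F i → 𝓕 F → ¬ (F ⊆[ s' ] X i)

isEcd-fromMax : ∀ {n r} {𝓕 : Family n} {s'} m →
  (∃ λ (X : Fin r → Subset n) → FreeFamily 𝓕 s' X × ∑[ i < r ] ∣ X i ∣ ≡ m) →
  (∀ (X : Fin r → Subset n) → FreeFamily 𝓕 s' X → ∑[ i < r ] ∣ X i ∣ ≤ m) →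
  IsEcd r 𝓕 s' (n ∸ m)
isEcd-fromMax {n} {r} {𝓕} {s'} m (X , X-free , ∑≡m) maximal =
  (∁ (⋃ᶠ X) , (X , partition , avoids) , ∣∁⋃∣≡n∸m) , minimal
  where
  open FreeFamily X-free
  partition : EquitablePartition r (∁ (⋃ᶠ X)) X
  partition = record
    { disjoint = disjoint
    ; inside   = λ i x∈Xᵢ → x∉p⇒x∈∁p (x∈p⇒x∉∁p (x∈⋃ᶠ⁺ X i x∈Xᵢ))
    ; covers   = λ x x∉∁⋃ → x∈⋃ᶠ⁻ X (x∉∁p⇒x∈p x∉∁⋃)
    ; balanced = balanced
    }
  ∣∁⋃∣≡n∸m : ∣ ∁ (⋃ᶠ X) ∣ ≡ n ∸ m
  ∣∁⋃∣≡n∸m = trans (∣∁p∣≡n∸∣p∣ (⋃ᶠ X)) (cong (n ∸_) (trans (∣⋃ᶠ∣≡∑∣∣ X disjoint) ∑≡m))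
  minimal : ∀ X₀ → Admissible r 𝓕 s' X₀ → n ∸ m ≤ ∣ X₀ ∣
  minimal X₀ (Y , Y-partition , Y-avoids) = m≤n+o⇒m∸n≤o n m (begin
    n                           ≤⟨ m≤n+m∸n n ∣ X₀ ∣ ⟩
    ∣ X₀ ∣ + (n ∸ ∣ X₀ ∣)        ≡⟨ cong (∣ X₀ ∣ +_) (∣∁p∣≡n∸∣p∣ X₀) ⟨
    ∣ X₀ ∣ + ∣ ∁ X₀ ∣           ≤⟨ +-monoʳ-≤ ∣ X₀ ∣ (p⊆q⇒∣p∣≤∣q∣ ∁X₀⊆⋃Y) ⟩
    ∣ X₀ ∣ + ∣ ⋃ᶠ Y ∣           ≡⟨ cong (∣ X₀ ∣ +_) (∣⋃ᶠ∣≡∑∣∣ Y Y.disjoint) ⟩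
    ∣ X₀ ∣ + ∑[ i < r ] ∣ Y i ∣ ≤⟨ +-monoʳ-≤ ∣ X₀ ∣ (maximal Y Y-free) ⟩
    ∣ X₀ ∣ + m                  ≡⟨ +-comm ∣ X₀ ∣ m ⟩
    m + ∣ X₀ ∣                  ∎)
    where
    open ≤-Reasoning
    module Y = EquitablePartition Y-partition
    Y-free : FreeFamily 𝓕 s' Y
    Y-free = record { disjoint = Y.disjoint ; balanced = Y.balanced ; avoids = Y-avoids }
    ∁X₀⊆⋃Y : ∁ X₀ ⊆ ⋃ᶠ Y
    ∁X₀⊆⋃Y x∈∁X₀ with i , x∈Yᵢ ← Y.covers _ (x∈∁p⇒x∉p x∈∁X₀) = x∈⋃ᶠ⁺ Y i x∈Yᵢ

∑-mono-≤ : ∀ {r} {f g : Fin r → ℕ} → (∀ i → f i ≤ g i) → ∑[ i < r ] f i ≤ ∑[ i < r ] g i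
∑-mono-≤ {zero}  f≤g = z≤n
∑-mono-≤ {suc r} f≤g = +-mono-≤ (f≤g zero) (∑-mono-≤ (f≤g ∘ suc))

∑-const : ∀ r c → ∑[ i < r ] c ≡ r * c
∑-const zero    c = refl
∑-const (suc r) c = cong (c +_) (∑-const r c)

m*n≤o*n+p⇒m≤o+p/n : ∀ m o p n .{{_ : NonZero n}} → m * n ≤ o * n + p → m ≤ o + p / n
m*n≤o*n+p⇒m≤o+p/n m o p n m*n≤ = begin
  m                 ≡⟨ m*n/n≡m m n ⟨
  m * n / n         ≤⟨ /-monoˡ-≤ n m*n≤ ⟩
  (o * n + p) / n   ≡⟨ +-distrib-/-∣ˡ p (n∣m*n o) ⟩
  o * n / n + p / n ≡⟨ cong (_+ p / n) (m*n/n≡m o n) ⟩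
  o + p / n         ∎
  where open ≤-Reasoning

largeSize : ℕ → ℕ → ℕ
largeSize c m with c <? m
... | yes _ = m
... | no  _ = 0

largeSize-of-large : ∀ {c m} → c < m → largeSize c m ≡ m
largeSize-of-large {c} {m} c<m with c <? m
... | yes _   = refl
... | no  c≮m = contradiction c<m c≮m

balanced-∑-bound : ∀ {r} c a (x : Fin r → ℕ) → Balanced x → ∑[ i < r ] largeSize c (x i) ≤ a →
  ∑[ i < r ] x i ≤ r * c + a / suc c ⊎ (r * suc c ≤ ∑[ i < r ] x i × ∑[ i < r ] x i ≤ a)
balanced-∑-bound {r} c a x x-balanced ∑large≤a with any? (λ i → x i ≤? c)
... | yes (j , xⱼ≤c) = inj₁ (m*n≤o*n+p⇒m≤o+p/n (∑[ i < r ] x i) (r * c) a (suc c) (begin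
  (∑[ i < r ] x i) * suc c                   ≡⟨ *-comm _ (suc c) ⟩
  suc c * ∑[ i < r ] x i                     ≡⟨ *-distribˡ-sum (suc c) x ⟩
  ∑[ i < r ] (suc c * x i)                   ≤⟨ ∑-mono-≤ (λ i → weighted (x i) (x≤1+c i)) ⟩
  ∑[ i < r ] (suc c * c + largeSize c (x i)) ≡⟨ ∑-distrib-+ (λ _ → suc c * c) (largeSize c ∘ x) ⟩
  ∑[ i < r ] (suc c * c) + ∑[ i < r ] largeSize c (x i)
                                             ≤⟨ +-mono-≤ (≤-reflexive (∑-const r (suc c * c))) ∑large≤a ⟩
  r * (suc c * c) + a                        ≡⟨ cong (λ m → r * m + a) (*-comm (suc c) c) ⟩
  r * (c * suc c) + a                        ≡⟨ cong (_+ a) (*-assoc r c (suc c)) ⟨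
  r * c * suc c + a                          ∎))
  where
  open ≤-Reasoning
  x≤1+c : ∀ i → x i ≤ suc c
  x≤1+c i = ≤-trans (x-balanced i j) (s≤s xⱼ≤c)
  weighted : ∀ m → m ≤ suc c → suc c * m ≤ suc c * c + largeSize c m
  weighted m m≤1+c with c <? m
  ... | yes c<m rewrite ≤-antisym m≤1+c c<m = ≤-reflexive (trans (*-suc (suc c) c) (+-comm (suc c) _))
  ... | no  c≮m = ≤-trans (*-monoʳ-≤ (suc c) (≮⇒≥ c≮m)) (m≤m+n _ 0)
... | no ∄xᵢ≤c = inj₂ ((begin
    r * suc c        ≡⟨ ∑-const r (suc c) ⟨
    ∑[ i < r ] suc c ≤⟨ ∑-mono-≤ c<x ⟩
    ∑[ i < r ] x i   ∎)
  , (begin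
    ∑[ i < r ] x i               ≡⟨ sum-cong-≗ (λ i → largeSize-of-large (c<x i)) ⟨
    ∑[ i < r ] largeSize c (x i) ≤⟨ ∑large≤a ⟩
    a                            ∎))
  where
  open ≤-Reasoning
  c<x : ∀ i → c < x i
  c<x i = ≰⇒> (λ xᵢ≤c → ∄xᵢ≤c (i , xᵢ≤c))

r*c+a/[1+c]≤a : ∀ r c a → r * suc c ≤ suc a → r * c + a / suc c ≤ a
r*c+a/[1+c]≤a r c a r[1+c]≤1+a with r ≤? a / suc c
... | yes r≤q = begin
  r * c + a / suc c         ≤⟨ +-monoˡ-≤ (a / suc c) (*-monoˡ-≤ c r≤q) ⟩
  a / suc c * c + a / suc c ≡⟨ +-comm (a / suc c * c) _ ⟩
  a / suc c + a / suc c * c ≡⟨ *-suc (a / suc c) c ⟨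
  a / suc c * suc c         ≤⟨ m/n*n≤m a (suc c) ⟩
  a                         ∎
  where open ≤-Reasoning
... | no r≰q = s≤s⁻¹ (begin
  suc (r * c + a / suc c) ≡⟨ +-suc (r * c) _ ⟨
  r * c + suc (a / suc c) ≤⟨ +-monoʳ-≤ (r * c) (≰⇒> r≰q) ⟩
  r * c + r               ≡⟨ +-comm (r * c) r ⟩
  r + r * c               ≡⟨ *-suc r c ⟨
  r * suc c               ≤⟨ r[1+c]≤1+a ⟩
  suc a                   ∎)
  where open ≤-Reasoning

-- Equitable packings

equitable : ∀ {r} → ℕ → ℕ → Fin r → ℕ
equitable zero    d _       = d
equitable (suc q) d zero    = suc d
equitable (suc q) d (suc i) = equitable q d i

d≤equitable : ∀ {r} q d (i : Fin r) → d ≤ equitable q d i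
d≤equitable zero    d _       = ≤-refl
d≤equitable (suc q) d zero    = n≤1+n d
d≤equitable (suc q) d (suc i) = d≤equitable q d i

equitable≤1+d : ∀ {r} q d (i : Fin r) → equitable q d i ≤ suc d
equitable≤1+d zero    d _       = n≤1+n d
equitable≤1+d (suc q) d zero    = ≤-refl
equitable≤1+d (suc q) d (suc i) = equitable≤1+d q d i

equitable-balanced : ∀ {r} q d → Balanced (equitable {r} q d)
equitable-balanced q d i j = ≤-trans (equitable≤1+d q d i) (s≤s (d≤equitable q d j))

∑-equitable : ∀ r q d → q ≤ r → ∑[ i < r ] equitable q d i ≡ r * d + q
∑-equitable zero    zero    d _         = refl
∑-equitable (suc r) zero    d _         =
  trans (cong (d +_) (∑-equitable r zero d z≤n)) (sym (+-assoc d (r * d) 0))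
∑-equitable (suc r) (suc q) d (s≤s q≤r) =
  trans (cong (suc d +_) (∑-equitable r q d q≤r)) (regroup d (r * d) q)
  where
  regroup : ∀ d e q → suc d + (e + q) ≡ d + e + suc q
  regroup = solve-∀

equitable-sizes⇒balanced : ∀ {r n} (X : Fin r → Subset n) q d →
  (∀ i → ∣ X i ∣ ≡ equitable q d i) → Balanced (∣_∣ ∘ X)
equitable-sizes⇒balanced X q d sizes i j =
  subst₂ (λ u v → u ≤ suc v) (sym (sizes i)) (sym (sizes j)) (equitable-balanced q d i j)

record Packing {r n} (A S : Subset n) (d : ℕ) (X : Fin r → Subset n) : Set where
  field
    disjoint : PairwiseDisjoint X
    within   : ∀ i → X i ⊆ A
    fits     : ∀ i → X i ⊆ S ⊎ ∣ X i ∣ ≤ d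

Packing-∷ : ∀ {r n d} {A S X₀ : Subset n} {X : Fin r → Subset n} → X₀ ⊆ A → X₀ ⊆ S ⊎ ∣ X₀ ∣ ≤ d →
  Packing (A ─ X₀) (S ─ X₀) d X → Packing A S d (X₀ Vector.∷ X)
Packing-∷ {d = d} {A} {S} {X₀} {X} X₀⊆A X₀-fits P =
  record { disjoint = disjoint′ ; within = within′ ; fits = fits′ }
  where
  open Packing P
  disjoint′ : PairwiseDisjoint (X₀ Vector.∷ X)
  disjoint′ zero    zero    0≢0 = contradiction refl 0≢0
  disjoint′ zero    (suc j) _   x x∈X₀ x∈Xⱼ = x∈p─q⇒x∉q A X₀ (within j x∈Xⱼ) x∈X₀
  disjoint′ (suc i) zero    _   x x∈Xᵢ x∈X₀ = x∈p─q⇒x∉q A X₀ (within i x∈Xᵢ) x∈X₀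
  disjoint′ (suc i) (suc j) i≢j = disjoint i j (i≢j ∘ cong suc)
  within′ : ∀ i → (X₀ Vector.∷ X) i ⊆ A
  within′ zero    = X₀⊆A
  within′ (suc i) = ⊆-trans (within i) (p─q⊆p A X₀)
  fits′ : ∀ i → (X₀ Vector.∷ X) i ⊆ S ⊎ ∣ (X₀ Vector.∷ X) i ∣ ≤ d
  fits′ zero    = X₀-fits
  fits′ (suc i) with fits i
  ... | inj₁ Xᵢ⊆S─X₀ = inj₁ (⊆-trans Xᵢ⊆S─X₀ (p─q⊆p S X₀))
  ... | inj₂ ∣Xᵢ∣≤d  = inj₂ ∣Xᵢ∣≤d

equitable-packing : ∀ {n} r q d (A S : Subset n) → q ≤ r → S ⊆ A →
  q * suc d ≤ ∣ S ∣ → ∑[ i < r ] equitable q d i ≤ ∣ A ∣ →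
  ∃ λ (X : Fin r → Subset n) → Packing A S d X × (∀ i → ∣ X i ∣ ≡ equitable q d i)
equitable-packing zero q d A S _ _ _ _ =
  (λ ()) , record { disjoint = λ () ; within = λ () ; fits = λ () } , λ ()
equitable-packing (suc r) zero d A S _ S⊆A _ ∣A∣≥
  with X₀ , X₀⊆A , ∣X₀∣≡d ← subset-of-size A d (≤-trans (m≤m+n d _) ∣A∣≥)
  with X , P , sizes ← equitable-packing r zero d (A ─ X₀) (S ─ X₀) z≤n (p⊆q⇒p─r⊆q─r X₀ S⊆A) z≤n
                         (m+k≤∣p∣⇒k≤∣p─q∣ X₀⊆A ∣X₀∣≡d ∣A∣≥)
  = X₀ Vector.∷ X , Packing-∷ X₀⊆A (inj₂ (≤-reflexive ∣X₀∣≡d)) P , λ { zero → ∣X₀∣≡d ; (suc i) → sizes i }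
equitable-packing (suc r) (suc q) d A S (s≤s q≤r) S⊆A ∣S∣≥ ∣A∣≥
  with X₀ , X₀⊆S , ∣X₀∣≡1+d ← subset-of-size S (suc d) (≤-trans (m≤m+n (suc d) _) ∣S∣≥)
  with X , P , sizes ← equitable-packing r q d (A ─ X₀) (S ─ X₀) q≤r (p⊆q⇒p─r⊆q─r X₀ S⊆A)
                         (m+k≤∣p∣⇒k≤∣p─q∣ X₀⊆S ∣X₀∣≡1+d ∣S∣≥)
                         (m+k≤∣p∣⇒k≤∣p─q∣ (⊆-trans X₀⊆S S⊆A) ∣X₀∣≡1+d ∣A∣≥)
  = X₀ Vector.∷ X , Packing-∷ (⊆-trans X₀⊆S S⊆A) (inj₁ X₀⊆S) P , λ { zero → ∣X₀∣≡1+d ; (suc i) → sizes i }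

-- The family H(n, s + c + 1, a, s)

fitting⇒H-avoiding : ∀ {n a s c} {p f : Subset n} → p ⊆ top n a ⊎ ∣ p ∣ ≤ c →
  H n (suc (s + c)) a s f → ¬ f ⊆[ s ] p
fitting⇒H-avoiding (inj₁ p⊆t) (_ , f⊈t) (e , ∣e∣≤s , f─e⊆p) = f⊈t (e , ∣e∣≤s , ⊆-trans f─e⊆p p⊆t)
fitting⇒H-avoiding {s = s} {c} {p} {f} (inj₂ ∣p∣≤c) (∣f∣≡k , _) f⊆p = <⇒≱ (n<1+n (s + c)) (begin
  suc (s + c) ≡⟨ ∣f∣≡k ⟨
  ∣ f ∣       ≤⟨ ⊆[]⇒∣∣≤∣∣+ f⊆p ⟩
  ∣ p ∣ + s   ≤⟨ +-monoˡ-≤ s ∣p∣≤c ⟩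
  c + s       ≡⟨ +-comm c s ⟩
  s + c       ∎)
  where open ≤-Reasoning

fitting⇒H-free : ∀ {n r a s c} {X : Fin r → Subset n} → PairwiseDisjoint X → Balanced (∣_∣ ∘ X) →
  (∀ i → X i ⊆ top n a ⊎ ∣ X i ∣ ≤ c) → FreeFamily (H n (suc (s + c)) a s) s X
fitting⇒H-free X# X-balanced fits = record
  { disjoint = X#
  ; balanced = X-balanced
  ; avoids   = λ f i f∈H → fitting⇒H-avoiding (fits i) f∈H
  }

largePart : ∀ {n} → ℕ → Subset n → Subset n
largePart c p with c <? ∣ p ∣
... | yes _ = p
... | no  _ = ⊥

∣largePart∣≡largeSize : ∀ {n} c (p : Subset n) → ∣ largePart c p ∣ ≡ largeSize c ∣ p ∣
∣largePart∣≡largeSize {n} c p with c <? ∣ p ∣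
... | yes _ = refl
... | no  _ = ∣⊥∣≡0 n

largePart⊆ : ∀ {n c} {p q : Subset n} → (c < ∣ p ∣ → p ⊆ q) → largePart c p ⊆ q
largePart⊆ {c = c} {p} p⊆q with c <? ∣ p ∣
... | yes c<∣p∣ = p⊆q c<∣p∣
... | no  _     = ⊥⊆

∑-largeSize≤ : ∀ {r n} c (X : Fin r → Subset n) {b : Subset n} → PairwiseDisjoint X →
  (∀ i → c < ∣ X i ∣ → X i ⊆ b) → ∑[ i < r ] largeSize c ∣ X i ∣ ≤ ∣ b ∣
∑-largeSize≤ {r} c X {b} X# large⊆b = begin
  ∑[ i < r ] largeSize c ∣ X i ∣   ≡⟨ sum-cong-≗ (λ i → ∣largePart∣≡largeSize c (X i)) ⟨
  ∑[ i < r ] ∣ largePart c (X i) ∣ ≡⟨ ∣⋃ᶠ∣≡∑∣∣ (largePart c ∘ X) L# ⟨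
  ∣ ⋃ᶠ (largePart c ∘ X) ∣         ≤⟨ p⊆q⇒∣p∣≤∣q∣ ⋃L⊆b ⟩
  ∣ b ∣                            ∎
  where
  open ≤-Reasoning
  L⊆X : ∀ i → largePart c (X i) ⊆ X i
  L⊆X i = largePart⊆ (λ _ → ⊆-refl)
  L# : PairwiseDisjoint (largePart c ∘ X)
  L# i j i≢j x x∈Lᵢ x∈Lⱼ = X# i j i≢j x (L⊆X i x∈Lᵢ) (L⊆X j x∈Lⱼ)
  ⋃L⊆b : ⋃ᶠ (largePart c ∘ X) ⊆ b
  ⋃L⊆b x∈ with i , x∈Lᵢ ← x∈⋃ᶠ⁻ (largePart c ∘ X) x∈ = largePart⊆ (large⊆b i) x∈Lᵢ

H-free⇒large-parts⊆top : ∀ {n r a s c} {X : Fin r → Subset n} → suc (s + c) ≤ n → a + s < n →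
  FreeFamily (H n (suc (s + c)) a s) s X → ∀ i → c < ∣ X i ∣ → X i ⊆ top n a
H-free⇒large-parts⊆top {n} {a = a} {X = X} k≤n a+s<n X-free i c<∣Xᵢ∣ {x} x∈Xᵢ with x ∈? top n a
... | yes x∈t = x∈t
... | no  x∉t with f , f∈H , f⊆Xᵢ ← large-escaping-part-contains k≤n (s<∣∁top∣ a+s<n) x∈Xᵢ x∉t c<∣Xᵢ∣
  = contradiction f⊆Xᵢ (FreeFamily.avoids X-free f i f∈H)

H-free⇒∑≤ : ∀ {n r a s c} {X : Fin r → Subset n} → suc (s + c) ≤ n → a + s < n →
  FreeFamily (H n (suc (s + c)) a s) s X →
  ∑[ i < r ] ∣ X i ∣ ≤ r * c + a / suc c ⊎ (r * suc c ≤ ∑[ i < r ] ∣ X i ∣ × ∑[ i < r ] ∣ X i ∣ ≤ a)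
H-free⇒∑≤ {n} {a = a} {s} {c} {X} k≤n a+s<n X-free =
  balanced-∑-bound c a (∣_∣ ∘ X) balanced (≤-trans
    (∑-largeSize≤ c X disjoint (H-free⇒large-parts⊆top k≤n a+s<n X-free))
    (≤-reflexive (∣top∣≡a (m+n≤o⇒m≤o a (<⇒≤ a+s<n)))))
  where open FreeFamily X-free

H-free-family-below : ∀ {n r a s c} → r * suc (s + c) ≤ n → a ≤ n → a < r * suc c →
  ∃ λ (X : Fin r → Subset n) →
    FreeFamily (H n (suc (s + c)) a s) s X × ∑[ i < r ] ∣ X i ∣ ≡ r * c + a / suc c
H-free-family-below {n} {r} {a} {s} {c} rk≤n a≤n a<r[1+c] =
  from-packing (equitable-packing r q c ⊤ (top n a) (<⇒≤ q<r) ⊆⊤ q[1+c]≤∣t∣ ∑≤∣⊤∣)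
  where
  q = a / suc c
  q<r : q < r
  q<r = m<n*o⇒m/o<n a<r[1+c]
  q[1+c]≤∣t∣ : q * suc c ≤ ∣ top n a ∣
  q[1+c]≤∣t∣ = ≤-trans (m/n*n≤m a (suc c)) (≤-reflexive (sym (∣top∣≡a a≤n)))
  ∑≤∣⊤∣ : ∑[ i < r ] equitable q c i ≤ ∣ ⊤ {n} ∣
  ∑≤∣⊤∣ = begin
    ∑[ i < r ] equitable q c i ≡⟨ ∑-equitable r q c (<⇒≤ q<r) ⟩
    r * c + q                  ≤⟨ +-monoʳ-≤ (r * c) (<⇒≤ q<r) ⟩
    r * c + r                  ≡⟨ trans (+-comm (r * c) r) (sym (*-suc r c)) ⟩
    r * suc c                  ≤⟨ *-monoʳ-≤ r (s≤s (m≤n+m c s)) ⟩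
    r * suc (s + c)            ≤⟨ rk≤n ⟩
    n                          ≡⟨ ∣⊤∣≡n n ⟨
    ∣ ⊤ {n} ∣                  ∎
    where open ≤-Reasoning
  from-packing : (∃ λ X → Packing ⊤ (top n a) c X × (∀ i → ∣ X i ∣ ≡ equitable q c i)) →
    ∃ λ (X : Fin r → Subset n) → FreeFamily (H n (suc (s + c)) a s) s X × ∑[ i < r ] ∣ X i ∣ ≡ r * c + q
  from-packing (X , P , sizes) =
    X , fitting⇒H-free disjoint (equitable-sizes⇒balanced X q c sizes) fits
      , trans (sum-cong-≗ sizes) (∑-equitable r q c (<⇒≤ q<r))
    where open Packing P

H-free-family-above : ∀ {n r a s c} .{{_ : NonZero r}} → a ≤ n →
  ∃ λ (X : Fin r → Subset n) → FreeFamily (H n (suc (s + c)) a s) s X × ∑[ i < r ] ∣ X i ∣ ≡ a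
H-free-family-above {n} {r} {a} {s} {c} a≤n =
  from-packing (equitable-packing r q d (top n a) (top n a) q≤r ⊆-refl q[1+d]≤∣t∣ (≤-reflexive ∑≡∣t∣))
  where
  q = a % r
  d = a / r
  q≤r : q ≤ r
  q≤r = <⇒≤ (m%n<n a r)
  ∑≡a : ∑[ i < r ] equitable q d i ≡ a
  ∑≡a = begin
    ∑[ i < r ] equitable q d i ≡⟨ ∑-equitable r q d q≤r ⟩
    r * d + q                  ≡⟨ trans (+-comm (r * d) q) (cong (q +_) (*-comm r d)) ⟩
    q + d * r                  ≡⟨ m≡m%n+[m/n]*n a r ⟨
    a                          ∎
    where open ≡-Reasoning
  ∑≡∣t∣ : ∑[ i < r ] equitable q d i ≡ ∣ top n a ∣
  ∑≡∣t∣ = trans ∑≡a (sym (∣top∣≡a a≤n))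
  q[1+d]≤∣t∣ : q * suc d ≤ ∣ top n a ∣
  q[1+d]≤∣t∣ = begin
    q * suc d   ≡⟨ *-suc q d ⟩
    q + q * d   ≤⟨ +-monoʳ-≤ q (*-monoˡ-≤ d q≤r) ⟩
    q + r * d   ≡⟨ +-comm q (r * d) ⟩
    r * d + q   ≡⟨ ∑-equitable r q d q≤r ⟨
    ∑[ i < r ] equitable q d i ≡⟨ ∑≡∣t∣ ⟩
    ∣ top n a ∣ ∎
    where open ≤-Reasoning
  from-packing : (∃ λ X → Packing (top n a) (top n a) d X × (∀ i → ∣ X i ∣ ≡ equitable q d i)) →
    ∃ λ (X : Fin r → Subset n) → FreeFamily (H n (suc (s + c)) a s) s X × ∑[ i < r ] ∣ X i ∣ ≡ a
  from-packing (X , P , sizes) =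
    X , fitting⇒H-free disjoint (equitable-sizes⇒balanced X q d sizes) (inj₁ ∘ within)
      , trans (sum-cong-≗ sizes) ∑≡a
    where open Packing P

ecd-H-below : ∀ {n r a s c} .{{_ : NonZero r}} → r * suc (s + c) ≤ n → a + s < n → a < r * suc c →
  IsEcd r (H n (suc (s + c)) a s) s (n ∸ (r * c + a / suc c))
ecd-H-below {n} {r} {a} {s} {c} rk≤n a+s<n a<r[1+c] =
  isEcd-fromMax _ (H-free-family-below rk≤n (m+n≤o⇒m≤o a (<⇒≤ a+s<n)) a<r[1+c]) maximal
  where
  maximal : ∀ X → FreeFamily (H n (suc (s + c)) a s) s X → ∑[ i < r ] ∣ X i ∣ ≤ r * c + a / suc c
  maximal X X-free with H-free⇒∑≤ (≤-trans (m≤n*m (suc (s + c)) r) rk≤n) a+s<n X-free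
  ... | inj₁ ∑≤ = ∑≤
  ... | inj₂ (r[1+c]≤∑ , ∑≤a) = contradiction a<r[1+c] (≤⇒≯ (≤-trans r[1+c]≤∑ ∑≤a))

ecd-H-above : ∀ {n r a s c} .{{_ : NonZero r}} → r * suc (s + c) ≤ n → a + s < n → r * suc c ≤ suc a →
  IsEcd r (H n (suc (s + c)) a s) s (n ∸ a)
ecd-H-above {n} {r} {a} {s} {c} rk≤n a+s<n r[1+c]≤1+a =
  isEcd-fromMax _ (H-free-family-above (m+n≤o⇒m≤o a (<⇒≤ a+s<n))) maximal
  where
  maximal : ∀ X → FreeFamily (H n (suc (s + c)) a s) s X → ∑[ i < r ] ∣ X i ∣ ≤ a
  maximal X X-free with H-free⇒∑≤ (≤-trans (m≤n*m (suc (s + c)) r) rk≤n) a+s<n X-free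
  ... | inj₁ ∑≤ = ≤-trans ∑≤ (r*c+a/[1+c]≤a r c a r[1+c]≤1+a)
  ... | inj₂ (_ , ∑≤a) = ∑≤a

1+[s+c]∸s≡1+c : ∀ s c → suc (s + c) ∸ s ≡ suc c
1+[s+c]∸s≡1+c s c = trans (+-∸-assoc 1 (m≤m+n s c)) (cong suc (m+n∸m≡n s c))

lemma3 : ∀ (n k r s a : ℕ) → 2 ≤ k → 2 ≤ r → r * k ≤ n → s < k → a + s < n →
    (a ≤ k ∸ s ∸ 1 → IsEcd r (H n k a s) s (n ∸ r * (k ∸ s ∸ 1)))
    × (k ∸ s ≤ a → a ≤ r * (k ∸ s) ∸ 2 →
        IsEcd r (H n k a s) s (n ∸ r * (k ∸ s ∸ 1) ∸ a / suc (k ∸ suc s)))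
    × (r * (k ∸ s) ∸ 1 ≤ a → IsEcd r (H n k a s) s (n ∸ a))
lemma3 n k r s a _ (s≤s (s≤s _)) rk≤n s<k a+s<n
  with c , refl ← m≤n⇒∃[o]m+o≡n s<k
  rewrite 1+[s+c]∸s≡1+c s c | m+n∸m≡n s c
  = small , medium , large
  where
  small : a ≤ c → IsEcd r (H n (suc (s + c)) a s) s (n ∸ r * c)
  small a≤c = subst (IsEcd r (H n (suc (s + c)) a s) s)
    (trans (cong (λ q → n ∸ (r * c + q)) (m<n⇒m/n≡0 (s≤s a≤c))) (cong (n ∸_) (+-identityʳ (r * c))))
    (ecd-H-below rk≤n a+s<n (≤-trans (s≤s a≤c) (m≤n*m (suc c) r)))
  medium : suc c ≤ a → a ≤ r * suc c ∸ 2 → IsEcd r (H n (suc (s + c)) a s) s (n ∸ r * c ∸ a / suc c)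
  medium _ a≤ = subst (IsEcd r (H n (suc (s + c)) a s) s) (sym (∸-+-assoc n (r * c) (a / suc c)))
    (ecd-H-below rk≤n a+s<n (≤-<-trans a≤ (s≤s (m∸n≤m _ 1))))
  large : r * suc c ∸ 1 ≤ a → IsEcd r (H n (suc (s + c)) a s) s (n ∸ a)
  large a≥ = ecd-H-above rk≤n a+s<n (≤-trans (m≤n+m∸n (r * suc c) 1) (s≤s a≥))
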